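{- Let $M=\langle C,\chi,\ell\rangle$ and $M'=\langle C',\chi',\ell'\rangle$ be simplicial models and $f:M\to M'$ a morphism of simplicial models. Let $X$ be a facet of $C$ and let $\varphi\in\mathcal{L}_K$ be a formula which contains no negations except possibly directly in front of atomic propositions. Then $M',f(X)\models\varphi$ implies $M,X\models\varphi$.
   Context: Agents $A=\{a_0,\ldots,a_n\}$; $\mathit{AP}=\{p_{a,x}\mid a\in A,x\in\mathcal{V}\}$ for a countable value set $\mathcal{V}$, $\mathit{AP}_a=\{p_{a,x}\mid x\in\mathcal{V}\}$. $\mathcal{L}_K$ is generated by $\varphi::=p\mid\neg\varphi\mid(\varphi\wedge\varphi)\mid K_a\varphi$ with $p\in\mathit{AP}$, $a\in A$. A simplicial model $\langle C,\chi,\ell\rangle$ is a simplicial complex $C$ all of whose facets (maximal simplexes) have $n+1$ vertices, with a coloring $\chi:\mathcal{V}(C)\to A$ giving distinct colors to the vertices of each simplex, and a labeling $\ell:\mathcal{V}(C)\to\mathscr{P}(\mathit{AP})$ with $\ell(v)\subseteq\mathit{AP}_{\chi(v)}$; for a facet $X$, $\ell(X)=\bigcup_{v\in X}\ell(v)$. A morphism of simplicial models $f:M\to M'$ is a map on vertices sending simplexes to simplexes, preserving colors ($\chi'(f(v))=\chi(v)$) and labels ($\ell'(f(v))=\ell(v)$); it sends facets to facets. Semantics at facets: $M,X\models p$ iff $p\in\ell(X)$; negation and conjunction as usual; $M,X\models K_a\varphi$ iff for every facet $Y$ with $a\in\chi(X\cap Y)$, $M,Y\models\varphi$. -}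

module Defs where

open import Data.Nat using (ℕ; suc)
open import Data.Fin using (Fin)
open import Data.Product using (Σ; _×_; _,_; ∃; ∃-syntax)
open import Data.List using (List; []; _∷_; length; map)
open import Data.List.Membership.Propositional using (_∈_)
open import Data.List.Relation.Unary.Unique.Propositional using (Unique)
open import Relation.Binary.PropositionalEquality using (_≡_)
open import Relation.Nullary using (¬_)
open import Function.Bundles using (_⇔_)
open import Function.Definitions using (Injective)

-- Agents a₀,…,aₙ are Fin (suc n).  Atomic propositions p_{a,x} are pairs (a , x).
Agent : ℕ → Set
Agent n = Fin (suc n)

AP : ℕ → Set → Set
AP n 𝒱 = Agent n × 𝒱

Countable : Set → Set
Countable 𝒱 = Σ (𝒱 → ℕ) λ e → Injective _≡_ _≡_ e

data Form (n : ℕ) (𝒱 : Set) : Set where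
  atom : AP n 𝒱 → Form n 𝒱
  neg  : Form n 𝒱 → Form n 𝒱
  and  : Form n 𝒱 → Form n 𝒱 → Form n 𝒱
  K    : Agent n → Form n 𝒱 → Form n 𝒱

data NegAtomsOnly {n : ℕ} {𝒱 : Set} : Form n 𝒱 → Set where
  pos : ∀ p → NegAtomsOnly (atom p)
  ngt : ∀ p → NegAtomsOnly (neg (atom p))
  cnj : ∀ {φ ψ} → NegAtomsOnly φ → NegAtomsOnly ψ → NegAtomsOnly (and φ ψ)
  knw : ∀ {a φ} → NegAtomsOnly φ → NegAtomsOnly (K a φ)

-- Finite vertex sets are represented by lists (order and repetitions irrelevant).
_⊆_ : {V : Set} → List V → List V → Set
xs ⊆ ys = ∀ {v} → v ∈ xs → v ∈ ys

HasCard : {V : Set} → List V → ℕ → Set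
HasCard xs k = ∃[ ys ] (Unique ys × ys ⊆ xs × xs ⊆ ys × length ys ≡ k)

record SimplicialComplex : Set₁ where
  field
    Vtx       : Set
    IsSimplex : List Vtx → Set
    nonempty  : ∀ {σ} → IsSimplex σ → ¬ (σ ≡ [])
    vertex    : ∀ v → IsSimplex (v ∷ [])
    downward  : ∀ {σ τ} → IsSimplex σ → τ ⊆ σ → ¬ (τ ≡ []) → IsSimplex τ

  IsFacet : List Vtx → Set
  IsFacet X = IsSimplex X × (∀ Y → IsSimplex Y → X ⊆ Y → Y ⊆ X)
open SimplicialComplex public

record SimplicialModel (n : ℕ) (𝒱 : Set) : Set₁ where
  field
    C    : SimplicialComplex
    χ    : Vtx C → Agent n
    ℓ    : Vtx C → AP n 𝒱 → Set
    pure : ∀ X → IsFacet C X → HasCard X (suc n)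
    chromatic : ∀ σ → IsSimplex C σ → ∀ {u w} → u ∈ σ → w ∈ σ → χ u ≡ χ w → u ≡ w
    ℓ-local   : ∀ v a x → ℓ v (a , x) → a ≡ χ v
open SimplicialModel public

_∈ℓ_ : ∀ {n 𝒱} {M : SimplicialModel n 𝒱} → AP n 𝒱 → List (Vtx (C M)) → Set
_∈ℓ_ {M = M} p X = ∃[ v ] (v ∈ X × ℓ M v p)

_∈χ∩_,_ : ∀ {n 𝒱} {M : SimplicialModel n 𝒱} → Agent n → List (Vtx (C M)) → List (Vtx (C M)) → Set
_∈χ∩_,_ {M = M} a X Y = ∃[ v ] (v ∈ X × v ∈ Y × χ M v ≡ a)

_,_⊨_ : ∀ {n 𝒱} (M : SimplicialModel n 𝒱) → List (Vtx (C M)) → Form n 𝒱 → Set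
M , X ⊨ atom p  = _∈ℓ_ {M = M} p X
M , X ⊨ neg φ   = ¬ (M , X ⊨ φ)
M , X ⊨ and φ ψ = (M , X ⊨ φ) × (M , X ⊨ ψ)
M , X ⊨ K a φ   = ∀ Y → IsFacet (C M) Y → _∈χ∩_,_ {M = M} a X Y → M , Y ⊨ φ

record Morphism {n 𝒱} (M M' : SimplicialModel n 𝒱) : Set where
  field
    fun       : Vtx (C M) → Vtx (C M')
    simplicial : ∀ σ → IsSimplex (C M) σ → IsSimplex (C M') (map fun σ)
    colour    : ∀ v → χ M' (fun v) ≡ χ M v
    label     : ∀ v p → ℓ M' (fun v) p ⇔ ℓ M v p
open Morphism public

module Submission where

-- Atoms and negated atoms transfer because f preserves labels,
-- so X and f(X) carry the same atomic propositions. For K_a φ, every facet Y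
-- sharing an a-coloured vertex with X is sent to a facet f(Y) sharing an
-- a-coloured vertex with f(X), so the hypothesis at f(X) yields φ at f(Y) and
-- induction gives φ at Y. Only this direction holds for K, which is why
-- negations may not occur above it. That morphisms preserve facets follows from
-- purity: a facet has one vertex of each colour, so any simplex containing its
-- image has no room for a further vertex.

open import Defs
open import Data.Nat using (ℕ; suc; _≤_)
open import Data.Nat.Properties using (1+n≰n)
open import Data.Fin using (Fin; punchOut)
open import Data.Fin.Properties using (_≟_; punchOut-injective; injective⇒≤)
open import Data.Product using (_×_; _,_; ∃-syntax)
open import Data.List using (List; _∷_; map; length; lookup)
open import Data.List.Membership.Propositional using (_∈_; find; lose)
open import Data.List.Membership.Propositional.Properties using (∈-lookup; ∈-map⁺; ∈-map⁻)
open import Data.List.Relation.Unary.Any using (any?)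
import Data.List.Relation.Unary.All as All
open import Data.List.Relation.Unary.AllPairs using (_∷_)
open import Data.List.Relation.Unary.Unique.Propositional using (Unique)
open import Relation.Binary.PropositionalEquality using (_≡_; _≢_; refl; sym; trans; cong; subst)
open import Relation.Nullary using (yes; no; contradiction)
open import Function.Bundles using (Equivalence)
open import Function.Definitions using (Injective)

lookup-injective : {A : Set} {xs : List A} → Unique xs → Injective _≡_ _≡_ (lookup xs)
lookup-injective {xs = _ ∷ _}  (_ ∷ _)  {Fin.zero}  {Fin.zero}  _ = refl
lookup-injective {xs = _ ∷ _}  (x∉ ∷ _) {Fin.zero}  {Fin.suc j} e = contradiction e (All.lookup x∉ (∈-lookup j))
lookup-injective {xs = _ ∷ _}  (x∉ ∷ _) {Fin.suc i} {Fin.zero}  e = contradiction (sym e) (All.lookup x∉ (∈-lookup i))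
lookup-injective {xs = _ ∷ xs} (_ ∷ u)  {Fin.suc i} {Fin.suc j} e = cong Fin.suc (lookup-injective u e)

InjectiveOn : {V B : Set} → (V → B) → List V → Set
InjectiveOn g ys = ∀ {u w} → u ∈ ys → w ∈ ys → g u ≡ g w → u ≡ w

-- If c were missed, punching it out would inject Fin (suc n) into Fin n.
colour-occurs : ∀ {n} {V : Set} (κ : V → Fin (suc n)) {ys : List V} →
  Unique ys → InjectiveOn κ ys → length ys ≡ suc n →
  ∀ c → ∃[ v ] (v ∈ ys × κ v ≡ c)
colour-occurs {n} κ {ys} uniq κ-inj len c with any? (λ v → κ v ≟ c) ys
... | yes c-occurs = find c-occurs
... | no  c-missed = contradiction (subst (_≤ n) len (injective⇒≤ punched-injective)) 1+n≰n
  where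
  c≢ : ∀ k → c ≢ κ (lookup ys k)
  c≢ k e = c-missed (lose (∈-lookup k) (sym e))

  punched : Fin (length ys) → Fin n
  punched k = punchOut (c≢ k)

  punched-injective : Injective _≡_ _≡_ punched
  punched-injective {i} {j} e =
    lookup-injective uniq (κ-inj (∈-lookup i) (∈-lookup j) (punchOut-injective (c≢ i) (c≢ j) e))

module _ {n : ℕ} {𝒱 : Set} {M M' : SimplicialModel n 𝒱} (f : Morphism M M') where

  facet-image : ∀ {Y} → IsFacet (C M) Y → IsFacet (C M') (map (fun f) Y)
  facet-image {Y} Y-facet@(Y-simplex , _) with pure M Y Y-facet
  ... | ys , uniq , ys⊆Y , Y⊆ys , len = simplicial f Y Y-simplex , maximal
    where
    maximal : ∀ Z → IsSimplex (C M') Z → map (fun f) Y ⊆ Z → Z ⊆ map (fun f) Y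
    maximal Z Z-simplex fY⊆Z {w} w∈Z
      with colour-occurs (χ M) uniq (λ u∈ w∈ → chromatic M Y Y-simplex (ys⊆Y u∈) (ys⊆Y w∈)) len (χ M' w)
    ... | v , v∈ys , χv≡χw = subst (_∈ map (fun f) Y) fv≡w fv∈fY
      where
      fv∈fY = ∈-map⁺ (fun f) (ys⊆Y v∈ys)
      fv≡w = chromatic M' Z Z-simplex (fY⊆Z fv∈fY) w∈Z (trans (colour f v) χv≡χw)

  ⊨-reflect : ∀ X {φ} → NegAtomsOnly φ → M' , map (fun f) X ⊨ φ → M , X ⊨ φ
  ⊨-reflect X (pos p) (v' , v'∈fX , p∈ℓv') with ∈-map⁻ (fun f) v'∈fX
  ... | v , v∈X , refl = v , v∈X , Equivalence.to (label f v p) p∈ℓv'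
  ⊨-reflect X (ngt p) ¬p∈ℓfX (v , v∈X , p∈ℓv) =
    ¬p∈ℓfX (fun f v , ∈-map⁺ (fun f) v∈X , Equivalence.from (label f v p) p∈ℓv)
  ⊨-reflect X (cnj φ ψ) (fX⊨φ , fX⊨ψ) = ⊨-reflect X φ fX⊨φ , ⊨-reflect X ψ fX⊨ψ
  ⊨-reflect X (knw φ) fX⊨Kφ Y Y-facet (v , v∈X , v∈Y , χv≡a) =
    ⊨-reflect Y φ (fX⊨Kφ (map (fun f) Y) (facet-image Y-facet)
      (fun f v , ∈-map⁺ (fun f) v∈X , ∈-map⁺ (fun f) v∈Y , trans (colour f v) χv≡a))

theorem9 : (n : ℕ) (𝒱 : Set) → Countable 𝒱 →
    (M M' : SimplicialModel n 𝒱) (f : Morphism M M') →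
    (X : List (Vtx (C M))) → IsFacet (C M) X →
    (φ : Form n 𝒱) → NegAtomsOnly φ →
    M' , map (fun f) X ⊨ φ → M , X ⊨ φ
theorem9 _ _ _ _ _ f X _ _ = ⊨-reflect f X
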